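{- If $R\subseteq\mathbb N$ has large gaps, then $R$ is rich.
   Context: A set $R\subseteq\mathbb N$ has large gaps if $R$ is infinite, $0\notin R$, and for every integer $k>0$ there exists $q\in R$ such that $[\lfloor q/k\rfloor,\,k\cdot q]\cap R=\{q\}$ (here $[m,n]=\{\ell\in\mathbb N:m\le\ell\le n\}$). For $s$-dimensional vectors, $\bar a^{\top}\bar x=\sum_{j=1}^sa_jx_j$; $v+\mathbb N=\{v,v+1,\dots\}$. A set $R\subseteq\mathbb N$ is rich if for all $s,u,v\in\mathbb N$, all $\bar a_0\in\{0,1\}^s\setminus\{\bar0\}$, $\bar a_1,\dots,\bar a_u\in\mathbb N^s$ and all $c_1,\dots,c_u\in\mathbb N$ with $(\bar a_0,0)\ne(\bar a_i,c_i)$ for all $i\in\{1,\dots,u\}$, there exist $\bar x,\bar y\in(v+\mathbb N)^s$ such that $\bar a_0^{\top}\bar x\in R\iff\bar a_0^{\top}\bar y\notin R$, and $\bar a_i^{\top}\bar x-c_i\in R\iff\bar a_i^{\top}\bar y-c_i\in R$ for all $i\in\{1,\dots,u\}$. -}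

module Defs where

open import Data.Nat using (ℕ; zero; suc; _+_; _*_; _≤_; NonZero)
open import Data.Nat.DivMod using (_/_)
open import Data.Fin using (Fin)
open import Data.Product using (Σ; ∃; _×_)
open import Data.Empty using (⊥)
open import Relation.Nullary using (¬_)
open import Relation.Binary.PropositionalEquality using (_≡_)
open import Function.Bundles using (_⇔_)

Subset : Set₁
Subset = ℕ → Set

dot : ∀ {s} → (Fin s → ℕ) → (Fin s → ℕ) → ℕ
dot {zero}  a x = 0
dot {suc s} a x = a Fin.zero * x Fin.zero + dot (λ j → a (Fin.suc j)) (λ j → x (Fin.suc j))

-- "n - c ∈ R" for integer subtraction: since R ⊆ ℕ, this holds iff
-- some m ∈ R has m + c = n (if n < c then n - c is negative, hence ∉ R).
_─_∈_ : ℕ → ℕ → Subset → Set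
n ─ c ∈ R = Σ ℕ λ m → (m + c ≡ n) × R m

Infinite : Subset → Set
Infinite R = ∀ n → Σ ℕ λ m → (n ≤ m) × R m

HasLargeGaps : Subset → Set
HasLargeGaps R =
  Infinite R × ¬ R 0 ×
  (∀ (k : ℕ) → .{{_ : NonZero k}} →
     Σ ℕ λ q → R q ×
       (∀ ℓ → q / k ≤ ℓ → ℓ ≤ k * q → R ℓ → ℓ ≡ q))

Rich : Subset → Set
Rich R =
  ∀ (s u v : ℕ)
    (a₀ : Fin s → ℕ) → (∀ j → a₀ j ≤ 1) → (Σ (Fin s) λ j → ¬ a₀ j ≡ 0) →
    (a : Fin u → Fin s → ℕ) (c : Fin u → ℕ) →
    (∀ i → ¬ ((∀ j → a i j ≡ a₀ j) × c i ≡ 0)) →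
    Σ (Fin s → ℕ) λ x → Σ (Fin s → ℕ) λ y →
      (∀ j → v ≤ x j) × (∀ j → v ≤ y j) ×
      (R (dot a₀ x) ⇔ (¬ R (dot a₀ y))) ×
      (∀ i → ((dot (a i) x) ─ c i ∈ R) ⇔ ((dot (a i) y) ─ c i ∈ R))

-- Let w exceed every coefficient, let P = (w, w², …, wˢ), and pick p so that
-- q = a₀ᵀP + p is an element of R that is the only one in [q/2, Kq] for a large K;
-- such q exist arbitrarily far out because R has large gaps.  Take x = P + p·e_{j₀}
-- and y = x + q·e_{j₀}.  Then a₀ᵀx = q ∈ R and a₀ᵀy = 2q ∉ R.  A form aᵢᵀ· − cᵢ with
-- aᵢ j₀ = 0 agrees at x and y.  Otherwise aᵢᵀy − cᵢ lies in (q, Kq], so not in R,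
-- while aᵢᵀx − cᵢ lies in [q/2, Kq], so it is in R only if it equals q; comparing
-- sizes this forces aᵢ j₀ = 1 and aᵢᵀP = a₀ᵀP + cᵢ, and reading both sides in base w
-- gives aᵢ = a₀ and cᵢ = 0, which is excluded.
module Submission where

open import Data.Empty using (⊥-elim)
open import Data.Fin using (Fin; zero; suc; toℕ)
import Data.Fin as Fin
open import Data.Nat
open import Data.Nat.DivMod using (_/_; _%_; m/n≤m; m/n*n≤m; /-monoʳ-≤; m<n⇒m%n≡m; [m+kn]%n≡m%n)
open import Data.Nat.Properties
open import Data.Nat.Tactic.RingSolver using (solve-∀)
open import Data.Product using (Σ; _×_; _,_; proj₁; proj₂)
open import Data.Vec.Functional using (updateAt; tail)
open import Data.Vec.Functional.Properties using (updateAt-updates; updateAt-minimal)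
open import Function using (id; _∘_)
open import Function.Bundles using (_⇔_; mk⇔)
open import Relation.Binary.PropositionalEquality
open import Relation.Nullary using (¬_; yes; no)
open import Algebra.Properties.CommutativeSemigroup +-commutativeSemigroup
  using (interchange; xy∙z≈xz∙y)
open import Algebra.Properties.CommutativeSemigroup *-commutativeSemigroup
  using (x∙yz≈y∙xz)

open import Defs

max : ∀ {n} → (Fin n → ℕ) → ℕ
max {zero}  f = 0
max {suc n} f = f zero ⊔ max (tail f)

≤-max : ∀ {n} (f : Fin n → ℕ) j → f j ≤ max f
≤-max f zero    = m≤m⊔n (f zero) _
≤-max f (suc j) = ≤-trans (≤-max (tail f) j) (m≤n⊔m (f zero) _)

dot-scaleʳ : ∀ {s} (a f : Fin s → ℕ) w → dot a (λ j → w * f j) ≡ w * dot a f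
dot-scaleʳ {zero}  a f w = sym (*-zeroʳ w)
dot-scaleʳ {suc s} a f w = begin
  a zero * (w * f zero) + dot (tail a) (λ j → w * f (suc j))
    ≡⟨ cong₂ _+_ (x∙yz≈y∙xz (a zero) w (f zero)) (dot-scaleʳ (tail a) (tail f) w) ⟩
  w * (a zero * f zero) + w * dot (tail a) (tail f)
    ≡⟨ *-distribˡ-+ w _ _ ⟨
  w * dot a f ∎
  where open ≡-Reasoning

dot-updateAt-+ : ∀ {s} (a f : Fin s → ℕ) j n →
                 dot a (updateAt f j (_+ n)) ≡ dot a f + a j * n
dot-updateAt-+ {suc s} a f zero    n = lemma (a zero) (f zero) n (dot (tail a) (tail f))
  where
  lemma : ∀ x y n d → x * (y + n) + d ≡ x * y + d + x * n
  lemma = solve-∀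
dot-updateAt-+ {suc s} a f (suc j) n =
  trans (cong (a zero * f zero +_) (dot-updateAt-+ (tail a) (tail f) j n))
        (sym (+-assoc (a zero * f zero) (dot (tail a) (tail f)) (a (suc j) * n)))

≤-updateAt-+ : ∀ {s} (f : Fin s → ℕ) j₀ n j → f j ≤ updateAt f j₀ (_+ n) j
≤-updateAt-+ f j₀ n j with j Fin.≟ j₀
... | yes refl = ≤-trans (m≤m+n (f j) n) (≤-reflexive (sym (updateAt-updates j f)))
... | no j≢j₀  = ≤-reflexive (sym (updateAt-minimal j j₀ f j≢j₀))

dot-updateAt-+-unit : ∀ {s} (a f : Fin s → ℕ) j n → a j ≡ 1 →
                      dot a (updateAt f j (_+ n)) ≡ dot a f + n
dot-updateAt-+-unit a f j n aj≡1 =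
  trans (dot-updateAt-+ a f j n)
        (trans (cong (λ α → dot a f + α * n) aj≡1) (cong (dot a f +_) (*-identityˡ n)))

digit-unique : ∀ {w a b X Y} .{{_ : NonZero w}} → a < w → b < w →
               a + w * X ≡ b + w * Y → a ≡ b × X ≡ Y
digit-unique {w} {a} {b} {X} {Y} a<w b<w eq = a≡b , X≡Y
  where
  open ≡-Reasoning
  eq′ : a + X * w ≡ b + Y * w
  eq′ = begin
    a + X * w ≡⟨ cong (a +_) (*-comm X w) ⟩
    a + w * X ≡⟨ eq ⟩
    b + w * Y ≡⟨ cong (b +_) (*-comm w Y) ⟩
    b + Y * w ∎
  a≡b : a ≡ b
  a≡b = begin
    a               ≡⟨ m<n⇒m%n≡m a<w ⟨
    a % w           ≡⟨ [m+kn]%n≡m%n a X w ⟨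
    (a + X * w) % w ≡⟨ cong (_% w) eq′ ⟩
    (b + Y * w) % w ≡⟨ [m+kn]%n≡m%n b Y w ⟩
    b % w           ≡⟨ m<n⇒m%n≡m b<w ⟩
    b               ∎
  X≡Y : X ≡ Y
  X≡Y = *-cancelˡ-≡ X Y w (+-cancelˡ-≡ a _ _ (trans eq (cong (_+ w * Y) (sym a≡b))))

evalBase : ℕ → ∀ {s} → (Fin s → ℕ) → ℕ
evalBase w a = dot a (λ j → w ^ toℕ j)

evalBase-suc : ∀ w {s} (a : Fin (suc s) → ℕ) →
               evalBase w a ≡ a zero + w * evalBase w (tail a)
evalBase-suc w a = cong₂ _+_ (*-identityʳ (a zero)) (dot-scaleʳ (tail a) (λ j → w ^ toℕ j) w)

evalBase-uncons : ∀ {s} w .{{_ : NonZero w}} {a b : Fin (suc s) → ℕ} →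
                  a zero < w → b zero < w → evalBase w a ≡ evalBase w b →
                  a zero ≡ b zero × evalBase w (tail a) ≡ evalBase w (tail b)
evalBase-uncons w {a} {b} a₀<w b₀<w eq =
  digit-unique a₀<w b₀<w (trans (sym (evalBase-suc w a)) (trans eq (evalBase-suc w b)))

evalBase-injective : ∀ {s} w .{{_ : NonZero w}} {a b : Fin s → ℕ} →
                     (∀ j → a j < w) → (∀ j → b j < w) →
                     evalBase w a ≡ evalBase w b → ∀ j → a j ≡ b j
evalBase-injective w {a} {b} a<w b<w eq zero =
  proj₁ (evalBase-uncons w {a} {b} (a<w zero) (b<w zero) eq)
evalBase-injective w {a} {b} a<w b<w eq (suc j) =
  evalBase-injective w (a<w ∘ suc) (b<w ∘ suc)
    (proj₂ (evalBase-uncons w {a} {b} (a<w zero) (b<w zero) eq)) j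

powers : ℕ → ∀ {s} → Fin s → ℕ
powers w j = w ^ suc (toℕ j)

≤-powers : ∀ w .{{_ : NonZero w}} {s} (j : Fin s) → w ≤ powers w j
≤-powers w j = m≤m*n w (w ^ toℕ j) {{m^n≢0 w (toℕ j)}}

powers-shift-injective : ∀ {s} w .{{_ : NonZero w}} {a b : Fin s → ℕ} {c} →
                         (∀ j → a j < w) → (∀ j → b j < w) → c < w →
                         dot a (powers w) ≡ dot b (powers w) + c →
                         (∀ j → a j ≡ b j) × c ≡ 0
powers-shift-injective w {a} {b} {c} a<w b<w c<w eq =
  evalBase-injective w a<w b<w (proj₂ digits) , sym (proj₁ digits)
  where
  open ≡-Reasoning
  digits : 0 ≡ c × evalBase w a ≡ evalBase w b
  digits = digit-unique (≤-trans (s≤s z≤n) c<w) c<w (begin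
    w * evalBase w a             ≡⟨ dot-scaleʳ a (λ j → w ^ toℕ j) w ⟨
    dot a (powers w)             ≡⟨ eq ⟩
    dot b (powers w) + c         ≡⟨ +-comm _ c ⟩
    c + dot b (powers w)         ≡⟨ cong (c +_) (dot-scaleʳ b (λ j → w ^ toℕ j) w) ⟩
    c + w * evalBase w b         ∎)

record Isolated (R : Subset) (K q : ℕ) : Set where
  field
    member : R q
    unique : ∀ ℓ → R ℓ → q ≤ ℓ + ℓ → ℓ ≤ K * q → ℓ ≡ q

open Isolated

/-≤-half : ∀ {q ℓ k} .{{_ : NonZero k}} → 2 ≤ k → q ≤ ℓ + ℓ → q / k ≤ ℓ
/-≤-half {q} {ℓ} {k} 2≤k q≤2ℓ = ≤-trans (/-monoʳ-≤ q 2≤k) (*-cancelʳ-≤ (q / 2) ℓ 2 (begin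
  q / 2 * 2 ≤⟨ m/n*n≤m q 2 ⟩
  q         ≤⟨ q≤2ℓ ⟩
  ℓ + ℓ     ≡⟨ cong (ℓ +_) (+-identityʳ ℓ) ⟨
  2 * ℓ     ≡⟨ *-comm 2 ℓ ⟩
  ℓ * 2     ∎))
  where open ≤-Reasoning

largeGaps⇒isolated-above : ∀ {R} → HasLargeGaps R → ∀ K N → Σ ℕ λ q → N ≤ q × Isolated R K q
largeGaps⇒isolated-above {R} (infinite , ¬R0 , gaps) K N
  with r , N≤r , Rr ← infinite N
  with q , Rq , unique ← gaps (2 + (r + K))
  = q , N≤q , record
    { member = Rq
    ; unique = λ ℓ Rℓ q≤2ℓ ℓ≤Kq → unique ℓ (/-≤-half 2≤k q≤2ℓ) (≤-trans ℓ≤Kq (*-monoˡ-≤ q K≤k)) Rℓ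
    }
  where
  k : ℕ
  k = 2 + (r + K)
  2≤k : 2 ≤ k
  2≤k = s≤s (s≤s z≤n)
  r+K≤k : r + K ≤ k
  r+K≤k = ≤-trans (n≤1+n _) (n≤1+n _)
  K≤k : K ≤ k
  K≤k = ≤-trans (m≤n+m K r) r+K≤k
  instance
    q≢0 : NonZero q
    q≢0 = ≢-nonZero (λ q≡0 → ¬R0 (subst R q≡0 Rq))
  -- Since r ≤ k, a q below N ≤ r would leave r ≠ q inside [q / k, k * q].
  N≤q : N ≤ q
  N≤q with N ≤? q
  ... | yes N≤q = N≤q
  ... | no N≰q  = ⊥-elim (<-irrefl (sym r≡q) (<-≤-trans q<N N≤r))
    where
    q<N : q < N
    q<N = ≰⇒> N≰q
    r≡q : r ≡ q
    r≡q = unique r (≤-trans (m/n≤m q k) (<⇒≤ (<-≤-trans q<N N≤r)))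
                   (≤-trans (≤-trans (m≤m+n r K) r+K≤k) (m≤m*n k q)) Rr

largeGaps⇒isolated-shift : ∀ {R} → HasLargeGaps R → ∀ K T L →
                           Σ ℕ λ p → L < p × Isolated R K (T + p)
largeGaps⇒isolated-shift gaps K T L
  with q , T+1+L≤q , isolated ← largeGaps⇒isolated-above gaps K (T + suc L)
  with p , refl ← m≤n⇒∃[o]m+o≡n (≤-trans (m≤m+n T (suc L)) T+1+L≤q)
  = p , +-cancelˡ-≤ T (suc L) p T+1+L≤q , isolated

module _ {R : Subset} {K q : ℕ} (isolated : Isolated R K q) where

  isolated⇒¬R-double : 2 ≤ K → ¬ R 0 → ¬ R (q + q)
  isolated⇒¬R-double 2≤K ¬R0 R2q = ¬R0 (subst R q≡0 (member isolated))
    where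
    2q≤Kq : q + q ≤ K * q
    2q≤Kq = ≤-trans (≤-reflexive (cong (q +_) (sym (+-identityʳ q)))) (*-monoˡ-≤ q 2≤K)
    2q≡q : q + q ≡ q
    2q≡q = unique isolated (q + q) R2q (≤-trans (m≤m+n q q) (m≤m+n (q + q) (q + q))) 2q≤Kq
    q≡0 : q ≡ 0
    q≡0 = +-cancelˡ-≡ q q 0 (trans 2q≡q (sym (+-identityʳ q)))

  isolated⇒long-translate∉ : ∀ {M c p d} → c < p → p ≤ q → M ≤ q → suc d + suc d < K →
                             ¬ ((M + suc d * (p + q)) ─ c ∈ R)
  isolated⇒long-translate∉ {M} {c} {p} {d} c<p p≤q M≤q 2α<K (m , m+c≡ , Rm) =
    <-irrefl (sym m≡q) q<m
    where
    open ≤-Reasoning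
    α : ℕ
    α = suc d
    q<m : q < m
    q<m = +-cancelʳ-< c q m (begin-strict
      q + c           <⟨ +-monoʳ-< q c<p ⟩
      q + p           ≡⟨ +-comm q p ⟩
      p + q           ≤⟨ m≤m+n (p + q) (d * (p + q)) ⟩
      α * (p + q)     ≤⟨ m≤n+m _ M ⟩
      M + α * (p + q) ≡⟨ m+c≡ ⟨
      m + c           ∎)
    m≤Kq : m ≤ K * q
    m≤Kq = begin
      m               ≤⟨ m≤m+n m c ⟩
      m + c           ≡⟨ m+c≡ ⟩
      M + α * (p + q) ≤⟨ +-mono-≤ M≤q (*-monoʳ-≤ α (+-monoˡ-≤ q p≤q)) ⟩
      q + α * (q + q) ≡⟨ cong (q +_) (trans (*-distribˡ-+ α q q) (sym (*-distribʳ-+ q α α))) ⟩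
      suc (α + α) * q ≤⟨ *-monoˡ-≤ q 2α<K ⟩
      K * q           ∎
    m≡q : m ≡ q
    m≡q = unique isolated m Rm (≤-trans (<⇒≤ q<m) (m≤m+n m m)) m≤Kq

  isolated⇒short-translate∈ : ∀ {M T c p d} → q ≡ T + p → T + (c + c) < p → M ≤ q →
                              suc d + suc d < K → (M + suc d * p) ─ c ∈ R →
                              M ≡ T + c
  isolated⇒short-translate∈ {M} {T} {c} {p} {d} q≡T+p T+2c<p M≤q 2α<K (m , m+c≡ , Rm) =
    single-step d (trans (cong (_+ c) (trans (sym q≡T+p) (sym m≡q))) m+c≡)
    where
    open ≤-Reasoning
    α : ℕ
    α = suc d
    p≤q : p ≤ q
    p≤q = ≤-trans (m≤n+m p T) (≤-reflexive (sym q≡T+p))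
    p≤m+c : p ≤ m + c
    p≤m+c = ≤-trans (≤-trans (m≤m+n p (d * p)) (m≤n+m _ M)) (≤-reflexive (sym m+c≡))
    T+c<p : T + c < p
    T+c<p = ≤-<-trans (+-monoʳ-≤ T (m≤m+n c c)) T+2c<p
    q<2m : q < m + m
    q<2m = +-cancelʳ-< (c + c) q (m + m) (begin-strict
      q + (c + c)           ≡⟨ cong (_+ (c + c)) q≡T+p ⟩
      T + p + (c + c)       ≡⟨ xy∙z≈xz∙y T p (c + c) ⟩
      T + (c + c) + p       <⟨ +-monoˡ-< p T+2c<p ⟩
      p + p                 ≤⟨ +-mono-≤ p≤m+c p≤m+c ⟩
      (m + c) + (m + c)     ≡⟨ interchange m c m c ⟩
      (m + m) + (c + c)     ∎)
    m≤Kq : m ≤ K * q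
    m≤Kq = begin
      m         ≤⟨ m≤m+n m c ⟩
      m + c     ≡⟨ m+c≡ ⟩
      M + α * p ≤⟨ +-mono-≤ M≤q (*-monoʳ-≤ α p≤q) ⟩
      suc α * q ≤⟨ *-monoˡ-≤ q (≤-trans (s≤s (m≤m+n α α)) 2α<K) ⟩
      K * q     ∎
    m≡q : m ≡ q
    m≡q = unique isolated m Rm (<⇒≤ q<2m) m≤Kq
    single-step : ∀ d → T + p + c ≡ M + suc d * p → M ≡ T + c
    single-step zero    eq = +-cancelʳ-≡ p M (T + c) (begin-equality
      M + p         ≡⟨ cong (M +_) (+-identityʳ p) ⟨
      M + 1 * p     ≡⟨ eq ⟨
      T + p + c     ≡⟨ xy∙z≈xz∙y T p c ⟩
      T + c + p     ∎)
    single-step (suc d) eq = ⊥-elim (<-irrefl eq (begin-strict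
      T + p + c                 ≡⟨ xy∙z≈xz∙y T p c ⟩
      T + c + p                 <⟨ +-monoˡ-< p T+c<p ⟩
      p + p                     ≤⟨ +-monoʳ-≤ p (m≤m+n p (d * p)) ⟩
      suc (suc d) * p           ≤⟨ m≤n+m _ M ⟩
      M + suc (suc d) * p       ∎))

unit-translate-separates :
  ∀ {R K p s} (f a₀ : Fin s → ℕ) j₀ → a₀ j₀ ≡ 1 → 2 ≤ K → ¬ R 0 →
  Isolated R K (dot a₀ f + p) →
  R (dot a₀ (updateAt f j₀ (_+ p))) ⇔ (¬ R (dot a₀ (updateAt f j₀ (_+ (p + (dot a₀ f + p))))))
unit-translate-separates {R} {p = p} f a₀ j₀ a₀j₀≡1 2≤K ¬R0 isolated =
  mk⇔ (λ _ → isolated⇒¬R-double isolated 2≤K ¬R0 ∘ subst R a₀y≡2q)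
      (λ _ → subst R (sym (dot-updateAt-+-unit a₀ f j₀ p a₀j₀≡1)) (member isolated))
  where
  q : ℕ
  q = dot a₀ f + p
  a₀y≡2q : dot a₀ (updateAt f j₀ (_+ (p + q))) ≡ q + q
  a₀y≡2q = trans (dot-updateAt-+-unit a₀ f j₀ (p + q) a₀j₀≡1) (sym (+-assoc (dot a₀ f) p q))

translate-invariant :
  ∀ {R K p w A s} .{{_ : NonZero w}} {j₀ : Fin s} {a₀ b : Fin s → ℕ} {c} →
  Isolated R K (dot a₀ (powers w) + p) → dot a₀ (powers w) + (A + A) + dot b (powers w) < p →
  A + A < K → A < w → (∀ j → a₀ j < w) → (∀ j → b j ≤ A) → c ≤ A →
  ¬ ((∀ j → b j ≡ a₀ j) × c ≡ 0) →
  let q = dot a₀ (powers w) + p in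
  (dot b (updateAt (powers w) j₀ (_+ p)) ─ c ∈ R) ⇔
  (dot b (updateAt (powers w) j₀ (_+ (p + q))) ─ c ∈ R)
translate-invariant {R} {K} {p} {w} {A} {j₀ = j₀} {a₀} {b} {c}
                    isolated p-large 2A<K A<w a₀<w b≤A c≤A distinct =
  subst₂ (λ X Y → (X ─ c ∈ R) ⇔ (Y ─ c ∈ R))
    (sym (dot-updateAt-+ b (powers w) j₀ p)) (sym (dot-updateAt-+ b (powers w) j₀ (p + q)))
    (invariant (b j₀) refl)
  where
  M T q : ℕ
  M = dot b (powers w)
  T = dot a₀ (powers w)
  q = T + p
  T+2c<p : T + (c + c) < p
  T+2c<p = ≤-<-trans (≤-trans (+-monoʳ-≤ T (+-mono-≤ c≤A c≤A)) (m≤m+n _ M)) p-large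
  c<p : c < p
  c<p = ≤-<-trans (≤-trans (m≤m+n c c) (m≤n+m _ T)) T+2c<p
  M≤q : M ≤ q
  M≤q = ≤-trans (≤-trans (m≤n+m M _) (<⇒≤ p-large)) (m≤n+m p T)
  invariant : ∀ α → b j₀ ≡ α → ((M + α * p) ─ c ∈ R) ⇔ ((M + α * (p + q)) ─ c ∈ R)
  invariant zero    _    = mk⇔ id id
  invariant (suc d) bj₀≡ =
    mk⇔ (⊥-elim ∘ ¬short) (⊥-elim ∘ isolated⇒long-translate∉ isolated c<p (m≤n+m p T) M≤q 2α<K)
    where
    2α<K : suc d + suc d < K
    2α<K = ≤-<-trans (subst (λ α → α + α ≤ A + A) bj₀≡ (+-mono-≤ (b≤A j₀) (b≤A j₀))) 2A<K
    ¬short : ¬ ((M + suc d * p) ─ c ∈ R)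
    ¬short = distinct
           ∘ powers-shift-injective w (λ j → ≤-<-trans (b≤A j) A<w) a₀<w (≤-<-trans c≤A A<w)
           ∘ isolated⇒short-translate∈ isolated refl T+2c<p M≤q 2α<K

separating-shifts :
  ∀ {R s u} → HasLargeGaps R → ∀ w .{{_ : NonZero w}} A (j₀ : Fin s) (a₀ : Fin s → ℕ)
  (a : Fin u → Fin s → ℕ) (c : Fin u → ℕ) →
  A < w → (∀ j → a₀ j < w) → a₀ j₀ ≡ 1 → (∀ i j → a i j ≤ A) → (∀ i → c i ≤ A) →
  (∀ i → ¬ ((∀ j → a i j ≡ a₀ j) × c i ≡ 0)) →
  Σ ℕ λ p → Σ ℕ λ p′ →
    (R (dot a₀ (updateAt (powers w) j₀ (_+ p))) ⇔ (¬ R (dot a₀ (updateAt (powers w) j₀ (_+ p′))))) ×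
    (∀ i → (dot (a i) (updateAt (powers w) j₀ (_+ p)) ─ c i ∈ R) ⇔
           (dot (a i) (updateAt (powers w) j₀ (_+ p′)) ─ c i ∈ R))
separating-shifts {R} gaps@(_ , ¬R0 , _) w A j₀ a₀ a c A<w a₀<w a₀j₀≡1 a≤A c≤A distinct =
  p , p + (T + p)
  , unit-translate-separates (powers w) a₀ j₀ a₀j₀≡1 (s≤s (s≤s z≤n)) ¬R0 isolated
  , λ i → translate-invariant isolated (p-large i) (s≤s (n≤1+n _)) A<w a₀<w (a≤A i) (c≤A i) (distinct i)
  where
  T B : ℕ
  T = dot a₀ (powers w)
  B = max (λ i → dot (a i) (powers w))
  chosen : Σ ℕ λ p → T + (A + A) + B < p × Isolated R (suc (suc (A + A))) (T + p)
  chosen = largeGaps⇒isolated-shift gaps (suc (suc (A + A))) T (T + (A + A) + B)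
  p : ℕ
  p = proj₁ chosen
  p-large : ∀ i → T + (A + A) + dot (a i) (powers w) < p
  p-large i = ≤-<-trans (+-monoʳ-≤ (T + (A + A)) (≤-max (λ i → dot (a i) (powers w)) i))
                        (proj₁ (proj₂ chosen))
  isolated : Isolated R (suc (suc (A + A))) (T + p)
  isolated = proj₂ (proj₂ chosen)

proposition40 : (R : Subset) → HasLargeGaps R → Rich R
proposition40 R gaps s u v a₀ a₀≤1 (j₀ , a₀j₀≢0) a c distinct =
  let p , p′ , separates , preserves =
        separating-shifts gaps w A j₀ a₀ a c A<w a₀<w a₀j₀≡1 a≤A c≤A distinct
  in updateAt (powers w) j₀ (_+ p) , updateAt (powers w) j₀ (_+ p′)
     , v≤shift p , v≤shift p′ , separates , preserves
  where
  A w : ℕ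
  A = max (λ i → max (a i) ⊔ c i)
  w = suc (suc (A + v))
  a≤A : ∀ i j → a i j ≤ A
  a≤A i j = ≤-trans (≤-max (a i) j) (≤-trans (m≤m⊔n _ (c i)) (≤-max (λ i → max (a i) ⊔ c i) i))
  c≤A : ∀ i → c i ≤ A
  c≤A i = ≤-trans (m≤n⊔m (max (a i)) _) (≤-max (λ i → max (a i) ⊔ c i) i)
  A<w : A < w
  A<w = s≤s (≤-trans (m≤m+n A v) (n≤1+n _))
  a₀<w : ∀ j → a₀ j < w
  a₀<w j = s≤s (≤-trans (a₀≤1 j) (s≤s z≤n))
  a₀j₀≡1 : a₀ j₀ ≡ 1
  a₀j₀≡1 = ≤-antisym (a₀≤1 j₀) (n≢0⇒n>0 a₀j₀≢0)
  v≤shift : ∀ n j → v ≤ updateAt (powers w) j₀ (_+ n) j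
  v≤shift n j = ≤-trans (≤-trans (m≤n+m v A) (≤-trans (n≤1+n _) (n≤1+n _)))
                        (≤-trans (≤-powers w j) (≤-updateAt-+ (powers w) j₀ n j))
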